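{- For every graph $G$, $\gamma(G)\le\gamma_{\{2\}}(G)-1$.
   Context: $G=(V,E)$ finite simple graph (with at least one vertex), $N[v]$ closed neighborhood. $\gamma(G)$ is the minimum size of a dominating set (a set $D$ such that every vertex outside $D$ has a neighbor in $D$). $\gamma_{\{2\}}(G)$ is the minimum of $\sum_v f(v)$ over $f:V\to\{0,1,2\}$ with $\sum_{w\in N[v]}f(w)\ge 2$ for all $v$. -}

module Defs where

open import Data.Nat using (ℕ; suc; _+_; _≤_; _∸_)
open import Data.Fin using (Fin)
open import Data.Bool using (Bool; true; false; if_then_else_)
open import Data.List using (List; map)
open import Data.Nat.ListAction using (sum)
open import Data.List using () renaming (allFin to allFinL)
open import Data.Fin.Subset using (Subset; _∈_; ∣_∣)
open import Data.Product using (_×_; Σ; ∃; _,_)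
open import Relation.Binary.PropositionalEquality using (_≡_)

record Graph (n : ℕ) : Set where
  field
    adj   : Fin n → Fin n → Bool
    sym   : ∀ u v → adj u v ≡ adj v u
    irrefl : ∀ v → adj v v ≡ false

open Graph public

InClosedNbhd : ∀ {n} → Graph n → Fin n → Fin n → Set
InClosedNbhd G v u = (u ≡ v) Data.Sum.⊎ (adj G v u ≡ true)
  where import Data.Sum

IsDominating : ∀ {n} → Graph n → Subset n → Set
IsDominating G D = ∀ v → v Data.Fin.Subset.∉ D → ∃ λ u → (u ∈ D) × (adj G v u ≡ true)

IsDominationNumber : ∀ {n} → Graph n → ℕ → Set
IsDominationNumber G k =
  (∃ λ D → IsDominating G D × ∣ D ∣ ≡ k) × (∀ D → IsDominating G D → k ≤ ∣ D ∣)

closedNbhdSum : ∀ {n} → Graph n → (Fin n → ℕ) → Fin n → ℕ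
closedNbhdSum {n} G f v =
  f v + sum (map (λ u → if adj G v u then f u else 0) (allFinL n))

weight : ∀ {n} → (Fin n → ℕ) → ℕ
weight {n} f = sum (map f (allFinL n))

Is2DomFunction : ∀ {n} → Graph n → (Fin n → Fin 3) → Set
Is2DomFunction G f = ∀ v → 2 ≤ closedNbhdSum G (λ u → Data.Fin.toℕ (f u)) v

Is2DominationNumber : ∀ {n} → Graph n → ℕ → Set
Is2DominationNumber G m =
  (∃ λ f → Is2DomFunction G f × weight (λ u → Data.Fin.toℕ (f u)) ≡ m)
  × (∀ f → Is2DomFunction G f → m ≤ weight (λ u → Data.Fin.toℕ (f u)))

module Submission where

-- Let f be a minimum {2}-dominating function, of weight m = γ_{2}(G).  Some
-- vertex u has f(u) ≥ 1 (the closed neighbourhood of any vertex carries weight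
-- at least 2).  Lowering f by one at u decreases every closed-neighbourhood
-- sum by at most one, because u lies in each closed neighbourhood at most once;
-- so h = f − 𝟙ᵤ is a {1}-dominating function of weight m − 1.  The support of
-- any {1}-dominating function h is a dominating set, and it has at most
-- weight(h) elements.  Hence γ(G) ≤ m − 1.

open import Defs hiding (sym)
open import Data.Nat using (ℕ; zero; suc; _+_; _∸_; _≤_; z≤n; s≤s)
open import Data.Nat.Properties
  using (≤-trans; ≤-reflexive; ≤-pred; n≤1+n; m≤n+m; +-mono-≤; +-monoˡ-≤; +-monoʳ-≤;
         +-comm; m∸n+n≡m; +-0-commutativeMonoid; +-commutativeSemigroup;
         module ≤-Reasoning)
open import Data.Fin using (Fin; zero; suc; punchIn; toℕ)
open import Data.Fin.Properties using (_≟_; punchInᵢ≢i)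
open import Data.Fin.Subset using (Subset; _∈_; ∣_∣)
open import Data.Bool using (Bool; true; false; if_then_else_)
open import Data.List using (map; tabulate)
open import Data.List.Properties using (map-tabulate)
open import Data.Nat.ListAction using () renaming (sum to listSum)
open import Data.Vec using () renaming (tabulate to tabulateᵛ)
open import Data.Vec.Properties using (lookup∘tabulate; lookup⇒[]=)
open import Data.Product using (_×_; ∃; _,_; proj₁; proj₂)
open import Data.Sum using (_⊎_; inj₁; inj₂)
open import Data.Empty using (⊥-elim)
open import Function using (_∘_; id)
open import Relation.Nullary using (Dec; yes; no; does)
open import Relation.Binary.PropositionalEquality
  using (_≡_; _≢_; refl; sym; trans; cong; cong₂; subst; module ≡-Reasoning)
open import Algebra.Properties.CommutativeMonoid.Sum +-0-commutativeMonoid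
  using (sum; ∑-distrib-+; sum-remove; sum-cong-≗; sum-replicate-zero)
open import Algebra.Properties.CommutativeSemigroup +-commutativeSemigroup
  using (interchange)

listSum-tabulate : ∀ {n} (F : Fin n → ℕ) → listSum (tabulate F) ≡ sum F
listSum-tabulate {zero}  F = refl
listSum-tabulate {suc n} F = cong (F zero +_) (listSum-tabulate (F ∘ suc))

weight≡sum : ∀ {n} (F : Fin n → ℕ) → weight F ≡ sum F
weight≡sum F = trans (cong listSum (map-tabulate id F)) (listSum-tabulate F)

sum-mono : ∀ {n} {F H : Fin n → ℕ} → (∀ i → F i ≤ H i) → sum F ≤ sum H
sum-mono {zero}  F≤H = z≤n
sum-mono {suc n} F≤H = +-mono-≤ (F≤H zero) (sum-mono (F≤H ∘ suc))

sum-zero : ∀ {n} {F : Fin n → ℕ} → (∀ i → F i ≡ 0) → sum F ≡ 0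
sum-zero {n} F≡0 = trans (sum-cong-≗ F≡0) (sum-replicate-zero n)

positive-+ : ∀ a b → 1 ≤ a + b → (1 ≤ a) ⊎ (1 ≤ b)
positive-+ zero    b 1≤b = inj₂ 1≤b
positive-+ (suc a) b _   = inj₁ (s≤s z≤n)

sum-positive : ∀ {n} (F : Fin n → ℕ) → 1 ≤ sum F → ∃ λ i → 1 ≤ F i
sum-positive {suc n} F 1≤∑ with positive-+ (F zero) (sum (F ∘ suc)) 1≤∑
... | inj₁ 1≤F₀ = zero , 1≤F₀
... | inj₂ 1≤∑′ with sum-positive (F ∘ suc) 1≤∑′
...   | i , 1≤Fi = suc i , 1≤Fi

indicator : ∀ {n} → Fin n → Fin n → ℕ
indicator u w = if does (w ≟ u) then 1 else 0

indicator-self : ∀ {n} (u : Fin n) → indicator u u ≡ 1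
indicator-self u with u ≟ u
... | yes _ = refl
... | no u≢u = ⊥-elim (u≢u refl)

indicator-other : ∀ {n} {u w : Fin n} → w ≢ u → indicator u w ≡ 0
indicator-other {u = u} {w} w≢u with w ≟ u
... | yes w≡u = ⊥-elim (w≢u w≡u)
... | no _ = refl

sum-indicator : ∀ {n} (u : Fin n) → sum (indicator u) ≡ 1
sum-indicator {suc n} u = begin
  sum (indicator u)                 ≡⟨ sum-remove {i = u} (indicator u) ⟩
  indicator u u + sum others        ≡⟨ cong (_+ sum others) (indicator-self u) ⟩
  1 + sum others                    ≡⟨ cong (1 +_) (sum-zero (λ j → indicator-other (punchInᵢ≢i u j))) ⟩
  1                                 ∎
  where
  open ≡-Reasoning
  others : Fin n → ℕ
  others = indicator u ∘ punchIn u

isPositive : ℕ → Bool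
isPositive zero    = false
isPositive (suc _) = true

support : ∀ {n} → (Fin n → ℕ) → Subset n
support h = tabulateᵛ (isPositive ∘ h)

∈-support : ∀ {n} (h : Fin n → ℕ) {i} → 1 ≤ h i → i ∈ support h
∈-support h {i} 1≤hi = lookup⇒[]= i (support h) (trans (lookup∘tabulate (isPositive ∘ h) i) (positive 1≤hi))
  where
  positive : ∀ {x} → 1 ≤ x → isPositive x ≡ true
  positive (s≤s _) = refl

-- Each vertex of the support carries weight at least one.
support-size : ∀ {n} (h : Fin n → ℕ) → ∣ support h ∣ ≤ weight h
support-size h = subst (∣ support h ∣ ≤_) (sym (weight≡sum h)) (count≤sum h)
  where
  count≤sum : ∀ {n} (h : Fin n → ℕ) → ∣ support h ∣ ≤ sum h
  count≤sum {zero}  h = z≤n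
  count≤sum {suc n} h with h zero
  ... | zero  = count≤sum (h ∘ suc)
  ... | suc x = s≤s (≤-trans (count≤sum (h ∘ suc)) (m≤n+m _ x))

mask : Bool → ℕ → ℕ
mask c x = if c then x else 0

mask-≤ : ∀ c x → mask c x ≤ x
mask-≤ true  x = ≤-reflexive refl
mask-≤ false x = z≤n

mask-zero : ∀ c → mask c 0 ≡ 0
mask-zero true  = refl
mask-zero false = refl

mask-+ : ∀ c x y → mask c (x + y) ≡ mask c x + mask c y
mask-+ true  x y = refl
mask-+ false x y = refl

mask-positive : ∀ c x → 1 ≤ mask c x → (c ≡ true) × (1 ≤ x)
mask-positive true x 1≤x = refl , 1≤x

closedNbhdSum≡ : ∀ {n} (G : Graph n) (h : Fin n → ℕ) v →
  closedNbhdSum G h v ≡ h v + sum (λ w → mask (adj G v w) (h w))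
closedNbhdSum≡ G h v = cong (h v +_) (weight≡sum (λ w → mask (adj G v w) (h w)))

closedNbhd-positive : ∀ {n} (G : Graph n) (h : Fin n → ℕ) v → 1 ≤ closedNbhdSum G h v →
  ∃ λ w → InClosedNbhd G v w × (1 ≤ h w)
closedNbhd-positive G h v 1≤N with positive-+ (h v) _ (subst (1 ≤_) (closedNbhdSum≡ G h v) 1≤N)
... | inj₁ 1≤hv = v , inj₁ refl , 1≤hv
... | inj₂ 1≤∑ with sum-positive _ 1≤∑
...   | w , 1≤term with mask-positive (adj G v w) (h w) 1≤term
...     | adjacent , 1≤hw = w , inj₂ adjacent , 1≤hw

closedNbhdSum-+ : ∀ {n} (G : Graph n) {a b c : Fin n → ℕ} → (∀ w → c w ≡ a w + b w) →
  ∀ v → closedNbhdSum G c v ≡ closedNbhdSum G a v + closedNbhdSum G b v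
closedNbhdSum-+ G {a} {b} {c} c≡a+b v = begin
  closedNbhdSum G c v                          ≡⟨ closedNbhdSum≡ G c v ⟩
  c v + sum (nbr c)                            ≡⟨ cong₂ _+_ (c≡a+b v) (sum-cong-≗ nbr-split) ⟩
  (a v + b v) + sum (λ w → nbr a w + nbr b w)  ≡⟨ cong ((a v + b v) +_) (∑-distrib-+ (nbr a) (nbr b)) ⟩
  (a v + b v) + (sum (nbr a) + sum (nbr b))    ≡⟨ interchange (a v) (b v) _ _ ⟩
  (a v + sum (nbr a)) + (b v + sum (nbr b))    ≡⟨ sym (cong₂ _+_ (closedNbhdSum≡ G a v) (closedNbhdSum≡ G b v)) ⟩
  closedNbhdSum G a v + closedNbhdSum G b v    ∎
  where
  open ≡-Reasoning
  nbr : (Fin _ → ℕ) → Fin _ → ℕ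
  nbr h w = mask (adj G v w) (h w)
  nbr-split : ∀ w → nbr c w ≡ nbr a w + nbr b w
  nbr-split w = trans (cong (mask (adj G v w)) (c≡a+b w)) (mask-+ (adj G v w) (a w) (b w))

-- Every closed neighbourhood contains u at most once (no loops), so it carries
-- at most weight one under 𝟙ᵤ.
closedNbhdSum-indicator : ∀ {n} (G : Graph n) u v → closedNbhdSum G (indicator u) v ≤ 1
closedNbhdSum-indicator G u v = by-cases (v ≟ u)
  where
  nbr : Fin _ → Fin _ → ℕ
  nbr v w = mask (adj G v w) (indicator u w)
  no-loop : ∀ w → nbr u w ≡ 0
  no-loop w with w ≟ u
  ... | yes refl = cong (λ c → mask c 1) (irrefl G u)
  ... | no _     = mask-zero (adj G u w)
  by-cases : Dec (v ≡ u) → closedNbhdSum G (indicator u) v ≤ 1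
  by-cases (yes refl) = ≤-reflexive (begin
    closedNbhdSum G (indicator u) u   ≡⟨ closedNbhdSum≡ G (indicator u) u ⟩
    indicator u u + sum (nbr u)       ≡⟨ cong₂ _+_ (indicator-self u) (sum-zero no-loop) ⟩
    1                                 ∎)
    where open ≡-Reasoning
  by-cases (no v≢u) = begin
    closedNbhdSum G (indicator u) v   ≡⟨ closedNbhdSum≡ G (indicator u) v ⟩
    indicator u v + sum (nbr v)       ≡⟨ cong (_+ sum (nbr v)) (indicator-other v≢u) ⟩
    sum (nbr v)                       ≤⟨ sum-mono (λ w → mask-≤ (adj G v w) (indicator u w)) ⟩
    sum (indicator u)                 ≡⟨ sum-indicator u ⟩
    1                                 ∎
    where open ≤-Reasoning

-- h is a {k}-dominating function: every closed neighbourhood has weight ≥ k.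
-- A {2}-dominating function of Defs is exactly Dominates 2 applied to toℕ ∘ f.
Dominates : ∀ {n} → ℕ → Graph n → (Fin n → ℕ) → Set
Dominates k G h = ∀ v → k ≤ closedNbhdSum G h v

support-dominating : ∀ {n} (G : Graph n) (h : Fin n → ℕ) → Dominates 1 G h → IsDominating G (support h)
support-dominating G h dom v v∉D with closedNbhd-positive G h v (dom v)
... | w , inj₂ adjacent , 1≤hw = w , ∈-support h 1≤hw , adjacent
... | _ , inj₁ refl     , 1≤hv = ⊥-elim (v∉D (∈-support h 1≤hv))

lowerAt : ∀ {n} → Fin n → (Fin n → ℕ) → Fin n → ℕ
lowerAt u h w = h w ∸ indicator u w

lowerAt-split : ∀ {n} {h : Fin n → ℕ} {u} → 1 ≤ h u → ∀ w → h w ≡ lowerAt u h w + indicator u w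
lowerAt-split {h = h} {u} 1≤hu w = sym (m∸n+n≡m (indicator≤h (w ≟ u)))
  where
  indicator≤h : Dec (w ≡ u) → indicator u w ≤ h w
  indicator≤h (yes refl) = subst (_≤ h u) (sym (indicator-self u)) 1≤hu
  indicator≤h (no w≢u)   = subst (_≤ h w) (sym (indicator-other w≢u)) z≤n

weight-lowerAt : ∀ {n} {h : Fin n → ℕ} {u} → 1 ≤ h u → weight h ≡ suc (weight (lowerAt u h))
weight-lowerAt {h = h} {u} 1≤hu = begin
  weight h                                 ≡⟨ weight≡sum h ⟩
  sum h                                    ≡⟨ sum-cong-≗ (lowerAt-split {h = h} 1≤hu) ⟩
  sum (λ w → lowerAt u h w + indicator u w) ≡⟨ ∑-distrib-+ (lowerAt u h) (indicator u) ⟩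
  sum (lowerAt u h) + sum (indicator u)    ≡⟨ cong (sum (lowerAt u h) +_) (sum-indicator u) ⟩
  sum (lowerAt u h) + 1                    ≡⟨ +-comm _ 1 ⟩
  suc (sum (lowerAt u h))                  ≡⟨ cong suc (sym (weight≡sum (lowerAt u h))) ⟩
  suc (weight (lowerAt u h))               ∎
  where open ≡-Reasoning

-- Lowering a {k+1}-dominating function at a vertex of positive weight leaves a
-- {k}-dominating function: each closed-neighbourhood sum drops by at most one.
lowerAt-dominates : ∀ {n} (G : Graph n) {h : Fin n → ℕ} {u k} → 1 ≤ h u →
  Dominates (suc k) G h → Dominates k G (lowerAt u h)
lowerAt-dominates G {h} {u} {k} 1≤hu dom v = ≤-pred (begin
  suc k                                                              ≤⟨ dom v ⟩
  closedNbhdSum G h v                                                ≡⟨ closedNbhdSum-+ G {lowerAt u h} {indicator u} (lowerAt-split {h = h} 1≤hu) v ⟩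
  closedNbhdSum G (lowerAt u h) v + closedNbhdSum G (indicator u) v  ≤⟨ +-monoʳ-≤ _ (closedNbhdSum-indicator G u v) ⟩
  closedNbhdSum G (lowerAt u h) v + 1                                ≡⟨ +-comm _ 1 ⟩
  suc (closedNbhdSum G (lowerAt u h) v)                              ∎)
  where open ≤-Reasoning

mainTheorem13 : ∀ (n : ℕ) (G : Graph (suc n)) (k m : ℕ) →
    IsDominationNumber G k → Is2DominationNumber G m → k + 1 ≤ m
mainTheorem13 n G k m (_ , minimal) ((f , f-dominates , f-weight) , _) = begin
  k + 1           ≤⟨ +-monoˡ-≤ 1 (minimal D (support-dominating G h h-dominates)) ⟩
  ∣ D ∣ + 1       ≤⟨ +-monoˡ-≤ 1 (support-size h) ⟩
  weight h + 1    ≡⟨ +-comm _ 1 ⟩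
  suc (weight h)  ≡⟨ sym (weight-lowerAt {h = g} 1≤gu) ⟩
  weight g        ≡⟨ f-weight ⟩
  m               ∎
  where
  open ≤-Reasoning
  g : Fin (suc n) → ℕ
  g v = toℕ (f v)
  positive-vertex : ∃ λ u → InClosedNbhd G zero u × (1 ≤ g u)
  positive-vertex = closedNbhd-positive G g zero (≤-trans (n≤1+n 1) (f-dominates zero))
  u : Fin (suc n)
  u = proj₁ positive-vertex
  1≤gu : 1 ≤ g u
  1≤gu = proj₂ (proj₂ positive-vertex)
  h : Fin (suc n) → ℕ
  h = lowerAt u g
  h-dominates : Dominates 1 G h
  h-dominates = lowerAt-dominates G 1≤gu f-dominates
  D : Subset (suc n)
  D = support h
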